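{- Let $n\ge5$ and $s$ be integers with $1<s<n/2$, let $q=\lfloor n/s\rfloor$, $r=n-qs$, and let $X=\{(x_1,x_2)\in\mathbb{Z}^2: x_1+x_2s\equiv 0 \pmod n\}$. Then: (a) if $r\le q$ and $2r\le s+1$, then $\{(s,-1),(r,q)\}$ is a packed basis for $X$; (b) if $r\le q$ and $2r\ge s+1$, then $\{(s,-1),(r-s,q+1)\}$ is a packed basis for $X$; (c) if $r\ge q$ and $r+q\ge s+1$, then $\{(s,-1),(r-s,q+1)\}$ is a packed basis for $X$.
   Context: For $\mathbf{x}=(x_1,x_2)\in\mathbb{Z}^2$, $\|\mathbf{x}\|=|x_1|+|x_2|$. A basis for $X$ is a pair $\{\mathbf{a},\mathbf{b}\}$ of linearly independent vectors of $X$ such that every vector of $X$ is an integer linear combination of $\mathbf{a}$ and $\mathbf{b}$. A basis $\{\mathbf{a},\mathbf{b}\}$ is packed if $\max\{\|\mathbf{a}\|,\|\mathbf{b}\|\}\le\min\{\|\mathbf{a}-\mathbf{b}\|,\|\mathbf{a}+\mathbf{b}\|\}$. -}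

module Defs where

open import Data.Integer using (ℤ; +_; _+_; _-_; _*_; -_; ∣_∣; 0ℤ)
open import Data.Integer.Divisibility using (_∣_)
open import Data.Nat using (ℕ; _≤_)
open import Data.Nat.Base using (_⊔_; _⊓_)
open import Data.Product using (_×_; _,_; Σ-syntax; ∃-syntax)
open import Relation.Binary.PropositionalEquality using (_≡_)

V : Set
V = ℤ × ℤ

_⊕_ : V → V → V
(a₁ , a₂) ⊕ (b₁ , b₂) = (a₁ + b₁ , a₂ + b₂)

_⊖_ : V → V → V
(a₁ , a₂) ⊖ (b₁ , b₂) = (a₁ - b₁ , a₂ - b₂)

_·_ : ℤ → V → V
k · (a₁ , a₂) = (k * a₁ , k * a₂)

‖_‖ : V → ℕ
‖ (a₁ , a₂) ‖ = ∣ a₁ ∣ Data.Nat.+ ∣ a₂ ∣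
  where import Data.Nat

InX : ℕ → ℕ → V → Set
InX n s (x₁ , x₂) = (+ n) ∣ (x₁ + x₂ * + s)

LinIndep : V → V → Set
LinIndep a b = ∀ (α β : ℤ) → (α · a) ⊕ (β · b) ≡ (0ℤ , 0ℤ) → (α ≡ 0ℤ) × (β ≡ 0ℤ)

IsBasis : (V → Set) → V → V → Set
IsBasis X a b =
  X a × X b × LinIndep a b ×
  (∀ x → X x → ∃[ α ] ∃[ β ] x ≡ (α · a) ⊕ (β · b))

IsPacked : V → V → Set
IsPacked a b = (‖ a ‖ ⊔ ‖ b ‖) ≤ (‖ a ⊖ b ‖ ⊓ ‖ a ⊕ b ‖)

IsPackedBasis : (V → Set) → V → V → Set
IsPackedBasis X a b = IsBasis X a b × IsPacked a b

module Submission where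

-- With φ(x) = x₁ + s x₂ we have X = φ⁻¹(nℤ), and a = (s, -1) spans ker φ; for any b the
-- determinant of (a, b) is φ(b), so {a, b} is a basis of X as soon as φ(b) = n. Division with
-- remainder gives φ(r, q) = n, and (r - s, q + 1) = (r, q) - a. Packedness is then four
-- inequalities between ℓ¹-norms which, after writing s = r + d, become the hypotheses on r, q, s.

open import Defs
open import Data.Nat using (ℕ; _≤_; _<_; _*_; _+_; _/_; _%_; NonZero)
open import Data.Integer using (+_; -_; _-_; -1ℤ)
open import Data.Product using (_×_; _,_)

open import Data.Nat using (zero; suc; s≤s; z≤n; ≢-nonZero; ≢-nonZero⁻¹)
open import Data.Nat.Properties
open import Data.Nat.DivMod using (m≡m%n+[m/n]*n; m%n<n; m*n/n≡m; /-monoˡ-≤)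
open import Data.Integer as ℤ using (ℤ; 0ℤ; 1ℤ; ∣_∣)
import Data.Integer.Properties as ℤ
open import Data.Integer.Divisibility.Signed using (divides; ∣⇒∣ᵤ; ∣ᵤ⇒∣)
open import Data.Integer.Tactic.RingSolver using (solve-∀; solve)
open import Data.Nat.Tactic.RingSolver using () renaming (solve to ℕ-solve)
open import Data.List using (_∷_; [])
open import Data.Product using (proj₂; ∃-syntax)
open import Data.Sum using ([_,_])
open import Function using (id)
open import Relation.Nullary using (contradiction)
open import Relation.Binary.PropositionalEquality
  using (_≡_; refl; sym; trans; cong; cong₂; module ≡-Reasoning)

φ : ℤ → V → ℤ
φ σ (x₁ , x₂) = x₁ ℤ.+ x₂ ℤ.* σ

φ-lincomb : ∀ σ α β (a b : V) →
            φ σ ((α · a) ⊕ (β · b)) ≡ α ℤ.* φ σ a ℤ.+ β ℤ.* φ σ b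
φ-lincomb σ α β (a₁ , a₂) (b₁ , b₂) = begin
  (α ℤ.* a₁ ℤ.+ β ℤ.* b₁) ℤ.+ (α ℤ.* a₂ ℤ.+ β ℤ.* b₂) ℤ.* σ
    ≡⟨ solve (σ ∷ α ∷ β ∷ a₁ ∷ a₂ ∷ b₁ ∷ b₂ ∷ []) ⟩
  α ℤ.* (a₁ ℤ.+ a₂ ℤ.* σ) ℤ.+ β ℤ.* (b₁ ℤ.+ b₂ ℤ.* σ) ∎
  where open ≡-Reasoning

φ-generator : ∀ σ → φ σ (σ , -1ℤ) ≡ 0ℤ
φ-generator σ = begin
  σ ℤ.+ -1ℤ ℤ.* σ ≡⟨ solve (σ ∷ []) ⟩
  0ℤ              ∎
  where open ≡-Reasoning

φ-⊖-generator : ∀ σ (b : V) → φ σ (b ⊖ (σ , -1ℤ)) ≡ φ σ b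
φ-⊖-generator σ (b₁ , b₂) = begin
  (b₁ - σ) ℤ.+ (b₂ - -1ℤ) ℤ.* σ   ≡⟨ solve (σ ∷ b₁ ∷ b₂ ∷ []) ⟩
  b₁ ℤ.+ b₂ ℤ.* σ                 ∎
  where open ≡-Reasoning

φ-decompose : ∀ σ k (x b : V) → φ σ x ≡ k ℤ.* φ σ b →
            x ≡ ((k ℤ.* proj₂ b - proj₂ x) · (σ , -1ℤ)) ⊕ (k · b)
φ-decompose σ k (x₁ , x₂) (b₁ , b₂) φx≡kφb = cong₂ _,_ first second
  where
  open ≡-Reasoning
  first : x₁ ≡ (k ℤ.* b₂ - x₂) ℤ.* σ ℤ.+ k ℤ.* b₁
  first = begin
    x₁                                  ≡⟨ solve (σ ∷ x₁ ∷ x₂ ∷ []) ⟩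
    (x₁ ℤ.+ x₂ ℤ.* σ) - x₂ ℤ.* σ        ≡⟨ cong (_- x₂ ℤ.* σ) φx≡kφb ⟩
    k ℤ.* (b₁ ℤ.+ b₂ ℤ.* σ) - x₂ ℤ.* σ
      ≡⟨ solve (σ ∷ k ∷ x₂ ∷ b₁ ∷ b₂ ∷ []) ⟩
    (k ℤ.* b₂ - x₂) ℤ.* σ ℤ.+ k ℤ.* b₁  ∎
  second : x₂ ≡ (k ℤ.* b₂ - x₂) ℤ.* -1ℤ ℤ.+ k ℤ.* b₂
  second = solve (k ∷ x₂ ∷ b₂ ∷ [])

isBasis-of-φ≡n : ∀ n s .{{_ : NonZero n}} (b : V) → φ (+ s) b ≡ + n →
               IsBasis (InX n s) (+ s , -1ℤ) b
isBasis-of-φ≡n n s b@(b₁ , b₂) φb≡n = a∈X , b∈X , independent , spanning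
  where
  open ≡-Reasoning
  a : V
  a = (+ s , -1ℤ)

  a∈X : InX n s a
  a∈X = ∣⇒∣ᵤ {+ n} {φ (+ s) a}
          (divides 0ℤ (trans (φ-generator (+ s)) (sym (ℤ.*-zeroˡ (+ n)))))

  b∈X : InX n s b
  b∈X = ∣⇒∣ᵤ {+ n} {φ (+ s) b} (divides 1ℤ (trans φb≡n (sym (ℤ.*-identityˡ (+ n)))))

  independent : LinIndep a b
  independent α β αa+βb≡0 = α≡0 , β≡0
    where
    βn≡0 : β ℤ.* + n ≡ 0ℤ
    βn≡0 = begin
      β ℤ.* + n
        ≡⟨ sym (ℤ.+-identityˡ _) ⟩
      0ℤ ℤ.+ β ℤ.* + n
        ≡⟨ cong (ℤ._+ β ℤ.* + n) (sym (ℤ.*-zeroʳ α)) ⟩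
      α ℤ.* 0ℤ ℤ.+ β ℤ.* + n
        ≡⟨ cong₂ (λ u v → α ℤ.* u ℤ.+ β ℤ.* v) (sym (φ-generator (+ s))) (sym φb≡n) ⟩
      α ℤ.* φ (+ s) a ℤ.+ β ℤ.* φ (+ s) b
        ≡⟨ sym (φ-lincomb (+ s) α β a b) ⟩
      φ (+ s) ((α · a) ⊕ (β · b))
        ≡⟨ cong (φ (+ s)) αa+βb≡0 ⟩
      0ℤ
        ∎
    β≡0 : β ≡ 0ℤ
    β≡0 = [ id , (λ n≡0 → contradiction (cong ∣_∣ n≡0) (≢-nonZero⁻¹ n)) ]
            (ℤ.i*j≡0⇒i≡0∨j≡0 β βn≡0)
    α≡0 : α ≡ 0ℤ
    α≡0 = begin
      α                             ≡⟨ solve (α ∷ b₂ ∷ []) ⟩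
      - (α ℤ.* -1ℤ ℤ.+ 0ℤ ℤ.* b₂)   ≡⟨ cong (λ β → - (α ℤ.* -1ℤ ℤ.+ β ℤ.* b₂)) (sym β≡0) ⟩
      - (α ℤ.* -1ℤ ℤ.+ β ℤ.* b₂)    ≡⟨ cong (λ v → - proj₂ v) αa+βb≡0 ⟩
      0ℤ                            ∎

  spanning : ∀ x → InX n s x → ∃[ α ] ∃[ β ] x ≡ (α · a) ⊕ (β · b)
  spanning x x∈X with ∣ᵤ⇒∣ {+ n} {φ (+ s) x} x∈X
  ... | divides k φx≡kn =
    k ℤ.* b₂ - proj₂ x , k ,
    φ-decompose (+ s) k x b (trans φx≡kn (cong (k ℤ.*_) (sym φb≡n)))

⊕-⊖-cancel : ∀ (a b : V) → a ⊕ (b ⊖ a) ≡ b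
⊕-⊖-cancel (a₁ , a₂) (b₁ , b₂) = cong₂ _,_ (i+[j-i]≡j a₁ b₁) (i+[j-i]≡j a₂ b₂)
  where
  i+[j-i]≡j : ∀ i j → i ℤ.+ (j - i) ≡ j
  i+[j-i]≡j = solve-∀

[m+n]⊖m≡n : ∀ m n → (m + n) ℤ.⊖ m ≡ + n
[m+n]⊖m≡n m n = trans (ℤ.⊖-≥ (m≤m+n m n)) (cong +_ (m+n∸m≡n m n))

∣+[m+n]-+m∣≡n : ∀ m n → ∣ + (m + n) - + m ∣ ≡ n
∣+[m+n]-+m∣≡n m n = cong ∣_∣ (trans (ℤ.[+m]-[+n]≡m⊖n (m + n) m) ([m+n]⊖m≡n m n))

+m-+[m+n]≡-+n : ∀ m n → + m - + (m + n) ≡ - + n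
+m-+[m+n]≡-+n m n = begin
  + m - + (m + n)      ≡⟨ ℤ.[+m]-[+n]≡m⊖n m (m + n) ⟩
  m ℤ.⊖ (m + n)        ≡⟨ ℤ.⊖-swap m (m + n) ⟩
  - ((m + n) ℤ.⊖ m)    ≡⟨ cong -_ ([m+n]⊖m≡n m n) ⟩
  - + n                ∎
  where open ≡-Reasoning

∣+m-+[m+n]∣≡n : ∀ m n → ∣ + m - + (m + n) ∣ ≡ n
∣+m-+[m+n]∣≡n m n = trans (cong ∣_∣ (+m-+[m+n]≡-+n m n)) (ℤ.∣-i∣≡∣i∣ (+ n))

∣-1-+m∣≡1+m : ∀ m → ∣ -1ℤ - + m ∣ ≡ suc m
∣-1-+m∣≡1+m zero    = refl
∣-1-+m∣≡1+m (suc m) = refl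

m≤n⇒2*m≤m+n : ∀ {m n} → m ≤ n → 2 * m ≤ m + n
m≤n⇒2*m≤m+n {m} m≤n = +-monoʳ-≤ m (≤-trans (≤-reflexive (+-identityʳ m)) m≤n)

n≤m⇒m+n≤2*m : ∀ {m n} → n ≤ m → m + n ≤ 2 * m
n≤m⇒m+n≤2*m {m} n≤m = +-monoʳ-≤ m (≤-trans n≤m (≤-reflexive (sym (+-identityʳ m))))

isPacked-intro : ∀ {a b} → ‖ a ‖ ≤ ‖ a ⊖ b ‖ → ‖ a ‖ ≤ ‖ a ⊕ b ‖ →
               ‖ b ‖ ≤ ‖ a ⊖ b ‖ → ‖ b ‖ ≤ ‖ a ⊕ b ‖ → IsPacked a b
isPacked-intro a≤a⊖b a≤a⊕b b≤a⊖b b≤a⊕b =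
  ⊔-lub (⊓-glb a≤a⊖b a≤a⊕b) (⊓-glb b≤a⊖b b≤a⊕b)

isPacked-[r,q] : ∀ {s r q} → r ≤ s → r ≤ q → 2 * r ≤ s + 1 → 2 ≤ q → 1 ≤ s →
               IsPacked (+ s , -1ℤ) (+ r , + q)
isPacked-[r,q] {r = r} r≤s r≤q 2r≤s+1 2≤q 1≤s
  with d , refl ← m≤n⇒∃[o]m+o≡n r≤s
  with o , refl ← m≤n⇒∃[o]m+o≡n 2≤q
  = isPacked-intro {a} {b} a≤a⊖b a≤a⊕b b≤a⊖b b≤a⊕b
  where
  open ≤-Reasoning
  a b : V
  a = (+ (r + d) , -1ℤ)
  b = (+ r , + (2 + o))

  ‖a⊖b‖≡ : ‖ a ⊖ b ‖ ≡ d + (3 + o)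
  ‖a⊖b‖≡ = cong (_+ (3 + o)) (∣+[m+n]-+m∣≡n r d)

  r≤d+1 : r ≤ d + 1
  r≤d+1 = +-cancelˡ-≤ r r (d + 1) (begin
    r + r        ≡⟨ ℕ-solve (r ∷ []) ⟩
    2 * r        ≤⟨ 2r≤s+1 ⟩
    r + d + 1    ≡⟨ +-assoc r d 1 ⟩
    r + (d + 1)  ∎)

  a≤a⊖b : ‖ a ‖ ≤ ‖ a ⊖ b ‖
  a≤a⊖b = begin
    r + d + 1            ≡⟨ ℕ-solve (r ∷ d ∷ []) ⟩
    r + (d + 1)          ≤⟨ +-monoˡ-≤ (d + 1) r≤q ⟩
    2 + o + (d + 1)      ≡⟨ ℕ-solve (d ∷ o ∷ []) ⟩
    d + (3 + o)          ≡⟨ sym ‖a⊖b‖≡ ⟩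
    ‖ a ⊖ b ‖            ∎

  a≤a⊕b : ‖ a ‖ ≤ ‖ a ⊕ b ‖
  a≤a⊕b = begin
    r + d + 1            ≤⟨ +-monoʳ-≤ (r + d) (m≤n+m 1 (r + o)) ⟩
    r + d + (r + o + 1)  ≡⟨ ℕ-solve (r ∷ d ∷ o ∷ []) ⟩
    r + d + r + (1 + o)  ∎

  b≤a⊖b : ‖ b ‖ ≤ ‖ a ⊖ b ‖
  b≤a⊖b = begin
    r + (2 + o)          ≤⟨ +-monoˡ-≤ (2 + o) r≤d+1 ⟩
    d + 1 + (2 + o)      ≡⟨ ℕ-solve (d ∷ o ∷ []) ⟩
    d + (3 + o)          ≡⟨ sym ‖a⊖b‖≡ ⟩
    ‖ a ⊖ b ‖            ∎

  b≤a⊕b : ‖ b ‖ ≤ ‖ a ⊕ b ‖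
  b≤a⊕b = begin
    r + (2 + o)          ≡⟨ ℕ-solve (r ∷ o ∷ []) ⟩
    1 + (r + (1 + o))    ≤⟨ +-monoˡ-≤ (r + (1 + o)) 1≤s ⟩
    r + d + (r + (1 + o)) ≡⟨ ℕ-solve (r ∷ d ∷ o ∷ []) ⟩
    r + d + r + (1 + o)  ∎

isPacked-[r-s,q+1] : ∀ {s r q} → r ≤ s → s + 1 ≤ r + q → s + 1 ≤ 2 * r →
              IsPacked (+ s , -1ℤ) ((+ r , + q) ⊖ (+ s , -1ℤ))
isPacked-[r-s,q+1] {r = r} {q} r≤s s+1≤r+q s+1≤2r
  with d , refl ← m≤n⇒∃[o]m+o≡n r≤s
  = isPacked-intro {a} {c} a≤a⊖c a≤a⊕c c≤a⊖c c≤a⊕c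
  where
  open ≤-Reasoning
  a b c : V
  a = (+ (r + d) , -1ℤ)
  b = (+ r , + q)
  c = b ⊖ a

  ‖c‖≡ : ‖ c ‖ ≡ d + (q + 1)
  ‖c‖≡ = cong (_+ (q + 1)) (∣+m-+[m+n]∣≡n r d)

  ‖a⊖c‖≡ : ‖ a ⊖ c ‖ ≡ r + d + d + suc (q + 1)
  ‖a⊖c‖≡ = cong₂ _+_
    (trans (cong (λ z → ∣ + (r + d) - z ∣) (+m-+[m+n]≡-+n r d))
           (cong (λ z → ∣ + (r + d) ℤ.+ z ∣) (ℤ.neg-involutive (+ d))))
    (∣-1-+m∣≡1+m (q + 1))

  d+1≤r : d + 1 ≤ r
  d+1≤r = +-cancelˡ-≤ r (d + 1) r (begin
    r + (d + 1)  ≡⟨ sym (+-assoc r d 1) ⟩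
    r + d + 1    ≤⟨ s+1≤2r ⟩
    2 * r        ≡⟨ ℕ-solve (r ∷ []) ⟩
    r + r        ∎)

  a≤a⊖c : ‖ a ‖ ≤ ‖ a ⊖ c ‖
  a≤a⊖c = begin
    r + d + 1              ≤⟨ +-mono-≤ (m≤m+n (r + d) d) (s≤s z≤n) ⟩
    r + d + d + suc (q + 1) ≡⟨ sym ‖a⊖c‖≡ ⟩
    ‖ a ⊖ c ‖              ∎

  a≤a⊕c : ‖ a ‖ ≤ ‖ a ⊕ c ‖
  a≤a⊕c = begin
    r + d + 1              ≤⟨ s+1≤r+q ⟩
    ‖ b ‖                  ≡⟨ cong ‖_‖ (sym (⊕-⊖-cancel a b)) ⟩
    ‖ a ⊕ c ‖              ∎

  c≤a⊖c : ‖ c ‖ ≤ ‖ a ⊖ c ‖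
  c≤a⊖c = begin
    ‖ c ‖                  ≡⟨ ‖c‖≡ ⟩
    d + (q + 1)            ≤⟨ +-mono-≤ (m≤n+m d (r + d)) (n≤1+n (q + 1)) ⟩
    r + d + d + suc (q + 1) ≡⟨ sym ‖a⊖c‖≡ ⟩
    ‖ a ⊖ c ‖              ∎

  c≤a⊕c : ‖ c ‖ ≤ ‖ a ⊕ c ‖
  c≤a⊕c = begin
    ‖ c ‖                  ≡⟨ ‖c‖≡ ⟩
    d + (q + 1)            ≡⟨ ℕ-solve (d ∷ q ∷ []) ⟩
    d + 1 + q              ≤⟨ +-monoˡ-≤ q d+1≤r ⟩
    ‖ b ‖                  ≡⟨ cong ‖_‖ (sym (⊕-⊖-cancel a b)) ⟩
    ‖ a ⊕ c ‖              ∎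

lemma2p5 : ∀ (n s : ℕ) .{{_ : NonZero s}} → 5 ≤ n → 1 < s → 2 * s < n →
    let q = n / s
        r = n % s
    in ((r ≤ q → 2 * r ≤ s + 1 →
          IsPackedBasis (InX n s) (+ s , -1ℤ) (+ r , + q))
     × (r ≤ q → s + 1 ≤ 2 * r →
          IsPackedBasis (InX n s) (+ s , -1ℤ) (+ r - + s , + (q + 1)))
     × (q ≤ r → s + 1 ≤ r + q →
          IsPackedBasis (InX n s) (+ s , -1ℤ) (+ r - + s , + (q + 1))))
lemma2p5 n s _ 1<s 2s<n =
    (λ r≤q 2r≤s+1 → isBasis-of-φ≡n n s b φb≡n ,
                    isPacked-[r,q] r≤s r≤q 2r≤s+1 2≤q (<⇒≤ 1<s))
  , (λ r≤q s+1≤2r → isBasis-of-φ≡n n s (b ⊖ a) φ[b-a]≡n ,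
                    isPacked-[r-s,q+1] r≤s (≤-trans s+1≤2r (m≤n⇒2*m≤m+n r≤q)) s+1≤2r)
  , (λ q≤r s+1≤r+q → isBasis-of-φ≡n n s (b ⊖ a) φ[b-a]≡n ,
                    isPacked-[r-s,q+1] r≤s s+1≤r+q (≤-trans s+1≤r+q (n≤m⇒m+n≤2*m q≤r)))
  where
  q = n / s
  r = n % s
  a b : V
  a = (+ s , -1ℤ)
  b = (+ r , + q)
  instance
    _ : NonZero n
    _ = ≢-nonZero (m<n⇒n≢0 2s<n)
  r≤s : r ≤ s
  r≤s = <⇒≤ (m%n<n n s)
  2≤q : 2 ≤ q
  2≤q = ≤-trans (≤-reflexive (sym (m*n/n≡m 2 s))) (/-monoˡ-≤ s (<⇒≤ 2s<n))
  φb≡n : φ (+ s) b ≡ + n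
  φb≡n = trans (cong (λ z → + r ℤ.+ z) (sym (ℤ.pos-* q s)))
               (cong +_ (sym (m≡m%n+[m/n]*n n s)))
  φ[b-a]≡n : φ (+ s) (b ⊖ a) ≡ + n
  φ[b-a]≡n = trans (φ-⊖-generator (+ s) b) φb≡n
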